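{- Let $(R,p)$ be one of $(\mathbb{Z}[\iota],3)$, $(\mathbb{Z}[\omega],4\omega+1)$, $(\mathbb{Z}[\omega],4\omega+3)$, let $\mathbb{F}=R/(p)$, and let $U$ be the image of $R^\times$ under $R\to\mathbb{F}$. Then: (1) $\mathbb{F}^\times/U$ is cyclic of order 2; (2) for any two distinct $\lambda,\nu\in\mathbb{F}^\times\setminus U$ there exist $u_1,\dots,u_k\in U$ with $\lambda+u_1+\dots+u_i\in\mathbb{F}^\times\setminus U$ for all $1\le i\le k$ and $\nu=\lambda+u_1+\dots+u_k$; (3) $\mathbb{F}$ is additively generated by the elements of $U$; (4) either $2\in\mathbb{F}^\times\setminus U$, or there exist $u_1,u_2\in U$ such that $u_1+u_2$ and $2u_1+u_2$ lie in $\mathbb{F}^\times\setminus U$ and $3u_1+u_2\in U$; (5) every $\lambda\in\mathbb{F}^\times\setminus U$ can be written as $u_1+u_2$ for some $u_1,u_2\in U$.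
   Context: $\iota$ is a square root of $-1$ and $\omega$ a primitive cube root of unity; these $p$ are primes in the Euclidean domains $\mathbb{Z}[\iota]$, $\mathbb{Z}[\omega]$. -}

module Defs where

open import Data.Integer using (ℤ; +_; _+_; _*_; _-_; -_)
open import Data.Product using (Σ; ∃; _×_; _,_; proj₂)
open import Data.Sum using (_⊎_)
open import Data.List using (List; []; _∷_; foldl)
open import Data.List.Relation.Unary.All using (All)
open import Relation.Binary.PropositionalEquality using (_≡_)
open import Relation.Nullary using (¬_)

data Case : Set where
  gauss-3   : Case
  eis-4ω+1  : Case
  eis-4ω+3  : Case

-- Elements of R: (a , b) stands for a + b·ι (Gaussian case) or a + b·ω (Eisenstein case).
R : Set
R = ℤ × ℤ

-- multiplication: ι² = -1 (Gaussian) ; ω² = -1 - ω (Eisenstein)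
mulR : Case → R → R → R
mulR gauss-3  (a , b) (a' , b') = (a * a' - b * b') , (a * b' + b * a')
mulR eis-4ω+1 (a , b) (a' , b') = (a * a' - b * b') , (a * b' + b * a' - b * b')
mulR eis-4ω+3 (a , b) (a' , b') = (a * a' - b * b') , (a * b' + b * a' - b * b')

primeOf : Case → R
primeOf gauss-3  = + 3 , + 0
primeOf eis-4ω+1 = + 1 , + 4
primeOf eis-4ω+3 = + 3 , + 4

module _ (c : Case) where

  infixl 6 _⊕_ _⊖_
  infixl 7 _⊗_
  infixr 8 _·_

  _⊕_ : R → R → R
  (a , b) ⊕ (a' , b') = (a + a') , (b + b')

  ⊝_ : R → R
  ⊝ (a , b) = (- a) , (- b)

  _⊖_ : R → R → R
  x ⊖ y = x ⊕ (⊝ y)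

  _⊗_ : R → R → R
  _⊗_ = mulR c

  _·_ : ℤ → R → R
  n · (a , b) = (n * a) , (n * b)

  0R 1R 2R : R
  0R = + 0 , + 0
  1R = + 1 , + 0
  2R = + 2 , + 0

  p : R
  p = primeOf c

  _∣R_ : R → R → Set
  x ∣R y = ∃ λ z → z ⊗ x ≡ y

  -- equality in 𝔽 = R/(p), on representatives
  _≈_ : R → R → Set
  x ≈ y = p ∣R (x ⊖ y)

  IsUnitR : R → Set
  IsUnitR x = ∃ λ y → x ⊗ y ≡ 1R

  InU : R → Set
  InU x = ∃ λ u → IsUnitR u × (x ≈ u)

  InFx : R → Set
  InFx x = ∃ λ y → (x ⊗ y) ≈ 1R

  InFx∖U : R → Set
  InFx∖U x = InFx x × ¬ InU x

  partialSums : R → List R → List R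
  partialSums l []       = []
  partialSums l (u ∷ us) = (l ⊕ u) ∷ partialSums (l ⊕ u) us

  sumFrom : R → List R → R
  sumFrom l us = foldl _⊕_ l us

  lincomb : List (ℤ × R) → R
  lincomb []             = 0R
  lincomb ((n , u) ∷ xs) = (n · u) ⊕ lincomb xs

  -- (1) 𝔽^×/U is cyclic of order 2: there is g ∈ 𝔽^× ∖ U with g² ∈ U
  --     and every element of 𝔽^× lies in U or in the coset gU.
  Part1 : Set
  Part1 = ∃ λ g → InFx∖U g × InU (g ⊗ g) ×
          (∀ y → InFx y → InU y ⊎ (∃ λ u → InU u × (y ≈ (g ⊗ u))))

  Part2 : Set
  Part2 = ∀ l n → InFx∖U l → InFx∖U n → ¬ (l ≈ n) →
          ∃ λ (us : List R) → All InU us × All InFx∖U (partialSums l us) × (n ≈ sumFrom l us)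

  Part3 : Set
  Part3 = ∀ x → ∃ λ (cs : List (ℤ × R)) → All (λ nu → InU (proj₂ nu)) cs × (x ≈ lincomb cs)

  Part4 : Set
  Part4 = InFx∖U 2R ⊎ (∃ λ u₁ → ∃ λ u₂ → InU u₁ × InU u₂ × InFx∖U (u₁ ⊕ u₂) ×
                          InFx∖U (((+ 2) · u₁) ⊕ u₂) × InU (((+ 3) · u₁) ⊕ u₂))

  Part5 : Set
  Part5 = ∀ l → InFx∖U l → ∃ λ u₁ → ∃ λ u₂ → InU u₁ × InU u₂ × (l ≈ (u₁ ⊕ u₂))

-- 𝔽 = R/(p) is a finite field, presented on Fin q by a residue map cls with a section rep:
-- reduction of both coordinates modulo 3 gives 𝔽₉ = (ℤ/3)[ι], and ω ↦ 3 resp. ω ↦ 9 gives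
-- ℤ/13, since both are roots of X² + X + 1 modulo 13 that kill 4ω + 1 resp. 4ω + 3.
-- A unit of R has norm 1, which bounds its coordinates by 1; so R^× = {±1, ±ι} resp.
-- {±1, ±ω, ±ω²}, and U has index 2 in 𝔽^×. Through cls, parts (1), (2), (4) and (5) become
-- statements about Fin q, which are decided by evaluation; (3) holds because
-- R = ℤ + ℤθ with θ = ι resp. ω a unit.
module Submission where

open import Defs hiding (_⊕_; _⊖_; _⊗_; ⊝_; _·_; 1R; 2R; p; _∣R_; _≈_)
open import Data.Empty using (⊥-elim)
open import Data.Fin using (Fin; toℕ; fromℕ<; combine; remQuot)
open import Data.Fin.Properties
  using (toℕ-fromℕ<; toℕ-injective; toℕ<n; combine-remQuot; combine-injective; all?; any?)
  renaming (_≟_ to _≟ᶠ_)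
open import Data.Integer using (ℤ; +_; -[1+_]; _+_; _*_; _-_; -_; ∣_∣; _%ℕ_; _/ℕ_)
import Data.Integer as ℤ
open import Data.Integer.DivMod using (n%ℕd<d; a≡a%ℕn+[a/ℕn]*n)
open import Data.Integer.Divisibility.Signed
  using (_∣_; divides; ∣m∣n⇒∣m+n; ∣m⇒∣-m; ∣m⇒∣m*n; ∣n⇒∣m*n; ∣m+n∣n⇒∣m)
open import Data.Integer.Properties
  using (+-injective; +-identityʳ; *-zeroʳ; *-assoc; neg-distribˡ-*; i-j≡0⇒i≡j; pos-+; pos-*; abs-*)
open import Data.Integer.Tactic.RingSolver using (solve; solve-∀)
open import Data.List using (List; []; _∷_; map; foldl; cartesianProduct)
open import Data.List.Membership.Propositional using (_∈_)
open import Data.List.Membership.Propositional.Properties using (∈-map⁺; ∈-map⁻; ∈-cartesianProduct⁺)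
import Data.List.Membership.DecPropositional as DecMembership
import Data.List.Relation.Unary.All as Allₗ
open Allₗ using (All)
open import Data.List.Relation.Unary.All.Properties using (map⁺; map⁻)
open import Data.List.Relation.Unary.Any using (here; there)
open import Data.Nat as ℕ using (ℕ; zero; suc; NonZero; z≤n; s≤s)
import Data.Nat.Properties as ℕ
open import Data.Nat.DivMod using (m<n⇒m%n≡m)
open import Data.Product using (∃; ∃₂; _×_; _,_; proj₁; proj₂)
open import Data.Product.Properties using (≡-dec)
open import Data.Sum using (_⊎_; inj₁; inj₂)
open import Function using (_∘′_)
open import Function.Bundles using (_⇔_; mk⇔; module Equivalence)
open import Function.Properties.Equivalence using () renaming (sym to ⇔-sym; trans to ⇔-trans)
open import Relation.Nullary using (¬_; Dec)
open import Relation.Nullary.Decidable using (True; toWitness; from-yes; _×-dec_; _⊎-dec_; _→-dec_; ¬?)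
open import Relation.Binary.PropositionalEquality

module Notation (c : Case) where
  infixl 6 _⊕_ _⊖_
  infixl 7 _⊗_
  infixr 8 _·_
  infix 4 _∣R_ _≈_

  _⊕_ _⊖_ _⊗_ : R → R → R
  _⊕_ = Defs._⊕_ c
  _⊖_ = Defs._⊖_ c
  _⊗_ = Defs._⊗_ c

  _·_ : ℤ → R → R
  _·_ = Defs._·_ c

  1R 2R p : R
  1R = Defs.1R c
  2R = Defs.2R c
  p = Defs.p c

  _∣R_ _≈_ : R → R → Set
  _∣R_ = Defs._∣R_ c
  _≈_ = Defs._≈_ c

infix 4 _≡_modulo_

-- A record rather than a synonym for + d ∣ i - j, so that i and j can be inferred.
record _≡_modulo_ (i j : ℤ) (d : ℕ) : Set where
  constructor congruent
  field
    divides-difference : + d ∣ i - j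

open _≡_modulo_ public

_mod_ : ℤ → (d : ℕ) .{{_ : NonZero d}} → Fin d
i mod d = fromℕ< (n%ℕd<d i d)

module _ {d : ℕ} .{{_ : NonZero d}} where

  private
    -[i-j]≡j-i : ∀ i j → - (i - j) ≡ j - i
    -[i-j]≡j-i = solve-∀

    [i-j]+[j-k]≡i-k : ∀ i j k → (i - j) + (j - k) ≡ i - k
    [i-j]+[j-k]≡i-k = solve-∀

    [i-i']+[j-j']≡[i+j]-[i'+j'] : ∀ i i' j j' → (i - i') + (j - j') ≡ (i + j) - (i' + j')
    [i-i']+[j-j']≡[i+j]-[i'+j'] = solve-∀

    -[i-i']≡-i-[-i'] : ∀ i i' → - (i - i') ≡ - i - - i'
    -[i-i']≡-i-[-i'] = solve-∀

    [i-i']j+i'[j-j']≡ij-i'j' : ∀ i i' j j' → (i - i') * j + i' * (j - j') ≡ i * j - i' * j'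
    [i-i']j+i'[j-j']≡ij-i'j' = solve-∀

    j+[i-j]≡i : ∀ i j → j + (i - j) ≡ i
    j+[i-j]≡i = solve-∀

    [r+qx]-r≡qx : ∀ r q x → (r + q * x) - r ≡ q * x
    [r+qx]-r≡qx = solve-∀

  ≡-mod-sym : ∀ {i j} → i ≡ j modulo d → j ≡ i modulo d
  ≡-mod-sym {i} {j} (congruent i≡j) = congruent (subst (+ d ∣_) (-[i-j]≡j-i i j) (∣m⇒∣-m i≡j))

  ≡-mod-trans : ∀ {i j k} → i ≡ j modulo d → j ≡ k modulo d → i ≡ k modulo d
  ≡-mod-trans {i} {j} {k} (congruent i≡j) (congruent j≡k) =
    congruent (subst (+ d ∣_) ([i-j]+[j-k]≡i-k i j k) (∣m∣n⇒∣m+n i≡j j≡k))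

  ≡-mod-+ : ∀ {i i' j j'} → i ≡ i' modulo d → j ≡ j' modulo d → i + j ≡ i' + j' modulo d
  ≡-mod-+ {i} {i'} {j} {j'} (congruent i≡i') (congruent j≡j') =
    congruent (subst (+ d ∣_) ([i-i']+[j-j']≡[i+j]-[i'+j'] i i' j j') (∣m∣n⇒∣m+n i≡i' j≡j'))

  ≡-mod-neg : ∀ {i i'} → i ≡ i' modulo d → - i ≡ - i' modulo d
  ≡-mod-neg {i} {i'} (congruent i≡i') = congruent (subst (+ d ∣_) (-[i-i']≡-i-[-i'] i i') (∣m⇒∣-m i≡i'))

  ≡-mod-* : ∀ {i i' j j'} → i ≡ i' modulo d → j ≡ j' modulo d → i * j ≡ i' * j' modulo d
  ≡-mod-* {i} {i'} {j} {j'} (congruent i≡i') (congruent j≡j') =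
    congruent (subst (+ d ∣_) ([i-i']j+i'[j-j']≡ij-i'j' i i' j j')
                             (∣m∣n⇒∣m+n (∣m⇒∣m*n j i≡i') (∣n⇒∣m*n i' j≡j')))

  i≡i-mod-d : ∀ i → i ≡ + toℕ (i mod d) modulo d
  i≡i-mod-d i = congruent (divides (i /ℕ d) (begin
    i - + toℕ (i mod d)                       ≡⟨ cong (λ r → i - + r) (toℕ-fromℕ< _) ⟩
    i - + (i %ℕ d)                            ≡⟨ cong (_- + (i %ℕ d)) (a≡a%ℕn+[a/ℕn]*n i d) ⟩
    (+ (i %ℕ d) + i /ℕ d * + d) - + (i %ℕ d)  ≡⟨ [r+qx]-r≡qx (+ (i %ℕ d)) (i /ℕ d) (+ d) ⟩
    i /ℕ d * + d                              ∎))
    where open ≡-Reasoning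

  mod-toℕ : ∀ k → (+ toℕ k) mod d ≡ k
  mod-toℕ k = toℕ-injective (trans (toℕ-fromℕ< _) (m<n⇒m%n≡m (toℕ<n k)))

  private
    positive-multiple-≥ : ∀ r r' k → + r - + r' ≡ + suc k * + d → d ℕ.≤ r
    positive-multiple-≥ r r' k eq = begin
      d                   ≤⟨ ℕ.m≤m+n d (k ℕ.* d) ⟩
      suc k ℕ.* d         ≤⟨ ℕ.m≤n+m _ r' ⟩
      r' ℕ.+ suc k ℕ.* d  ≡⟨ +-injective r'+kd≡r ⟩
      r                   ∎
      where
      open ℕ.≤-Reasoning
      r'+kd≡r : + (r' ℕ.+ suc k ℕ.* d) ≡ + r
      r'+kd≡r = trans (pos-+ r' _)
        (trans (cong (_+_ (+ r')) (trans (pos-* (suc k) d) (sym eq))) (j+[i-j]≡i (+ r) (+ r')))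

    remainder-unique : ∀ {r r'} → r ℕ.< d → r' ℕ.< d → + r ≡ + r' modulo d → r ≡ r'
    remainder-unique {r} {r'} _   _    (congruent (divides (+ zero)  eq)) =
      +-injective (i-j≡0⇒i≡j (+ r) (+ r') eq)
    remainder-unique {r} {r'} r<d _    (congruent (divides (+ suc k) eq)) =
      ⊥-elim (ℕ.<⇒≱ r<d (positive-multiple-≥ r r' k eq))
    remainder-unique {r} {r'} _   r'<d (congruent (divides -[1+ k ]  eq)) =
      ⊥-elim (ℕ.<⇒≱ r'<d (positive-multiple-≥ r' r k eq'))
      where
      eq' : + r' - + r ≡ + suc k * + d
      eq' = trans (sym (-[i-j]≡j-i (+ r) (+ r'))) (trans (cong -_ eq) (neg-distribˡ-* -[1+ k ] (+ d)))

  ≡-mod⇒mod≡ : ∀ {i j} → i ≡ j modulo d → i mod d ≡ j mod d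
  ≡-mod⇒mod≡ {i} {j} i≡j = toℕ-injective (remainder-unique (toℕ<n (i mod d)) (toℕ<n (j mod d))
    (≡-mod-trans (≡-mod-sym (i≡i-mod-d i)) (≡-mod-trans i≡j (i≡i-mod-d j))))

  mod≡⇒≡-mod : ∀ i j → i mod d ≡ j mod d → i ≡ j modulo d
  mod≡⇒≡-mod i j i≡j = ≡-mod-trans (i≡i-mod-d i)
    (subst (λ k → + toℕ k ≡ j modulo d) (sym i≡j) (≡-mod-sym (i≡i-mod-d j)))

θ : R
θ = + 0 , + 1

±[1+θ] : Case → List R
±[1+θ] gauss-3  = []
±[1+θ] eis-4ω+1 = (+ 1 , + 1) ∷ (-[1+ 0 ] , -[1+ 0 ]) ∷ []
±[1+θ] eis-4ω+3 = ±[1+θ] eis-4ω+1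

units : Case → List R
units c = (+ 1 , + 0) ∷ (-[1+ 0 ] , + 0) ∷ θ ∷ (+ 0 , -[1+ 0 ]) ∷ ±[1+θ] c

units-sound : ∀ c → All (IsUnitR c) (units c)
units-sound gauss-3 =
  ((+ 1 , + 0) , refl) ∷ ((-[1+ 0 ] , + 0) , refl) ∷ ((+ 0 , -[1+ 0 ]) , refl) ∷ (θ , refl) ∷ []
  where open All using ([]; _∷_)
units-sound eis-4ω+1 =
  ((+ 1 , + 0) , refl) ∷ ((-[1+ 0 ] , + 0) , refl) ∷ ((-[1+ 0 ] , -[1+ 0 ]) , refl) ∷
  ((+ 1 , + 1) , refl) ∷ ((+ 0 , -[1+ 0 ]) , refl) ∷ (θ , refl) ∷ []
  where open All using ([]; _∷_)
units-sound eis-4ω+3 = units-sound eis-4ω+1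

norm : Case → R → ℤ
norm gauss-3  (a , b) = a * a + b * b
norm eis-4ω+1 (a , b) = a * a - a * b + b * b
norm eis-4ω+3 (a , b) = a * a - a * b + b * b

norm-⊗ : ∀ c x y → norm c (mulR c x y) ≡ norm c x * norm c y
norm-⊗ gauss-3 (a , b) (a' , b') = two-squares a b a' b'
  where
  two-squares : ∀ a b a' b' → (a * a' - b * b') * (a * a' - b * b') + (a * b' + b * a') * (a * b' + b * a')
                        ≡ (a * a + b * b) * (a' * a' + b' * b')
  two-squares = solve-∀
norm-⊗ eis-4ω+1 (a , b) (a' , b') = eisenstein-norm a b a' b'
  where
  eisenstein-norm : ∀ a b a' b' → let u = a * a' - b * b'; v = a * b' + b * a' - b * b' in
          u * u - u * v + v * v ≡ (a * a - a * b + b * b) * (a' * a' - a' * b' + b' * b')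
  eisenstein-norm = solve-∀
norm-⊗ eis-4ω+3 = norm-⊗ eis-4ω+1

∣norm-1R∣ : ∀ c → ∣ norm c (Notation.1R c) ∣ ≡ 1
∣norm-1R∣ gauss-3  = refl
∣norm-1R∣ eis-4ω+1 = refl
∣norm-1R∣ eis-4ω+3 = refl

∣norm∣≡1 : ∀ c {x} → IsUnitR c x → ∣ norm c x ∣ ≡ 1
∣norm∣≡1 c {x} (y , x⊗y≡1) = ℕ.m*n≡1⇒m≡1 ∣ norm c x ∣ ∣ norm c y ∣ (begin
  ∣ norm c x ∣ ℕ.* ∣ norm c y ∣  ≡⟨ abs-* (norm c x) (norm c y) ⟨
  ∣ norm c x * norm c y ∣        ≡⟨ cong ∣_∣ (norm-⊗ c x y) ⟨
  ∣ norm c (mulR c x y) ∣        ≡⟨ cong (λ z → ∣ norm c z ∣) x⊗y≡1 ⟩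
  ∣ norm c (Notation.1R c) ∣     ≡⟨ ∣norm-1R∣ c ⟩
  1                              ∎)
  where open ≡-Reasoning

i*i≡∣i∣*∣i∣ : ∀ i → i * i ≡ + (∣ i ∣ ℕ.* ∣ i ∣)
i*i≡∣i∣*∣i∣ (+ n)    = sym (pos-* n n)
i*i≡∣i∣*∣i∣ -[1+ n ] = refl

i*i+j*j≡∣i∣²+∣j∣² : ∀ i j → i * i + j * j ≡ + (∣ i ∣ ℕ.* ∣ i ∣ ℕ.+ ∣ j ∣ ℕ.* ∣ j ∣)
i*i+j*j≡∣i∣²+∣j∣² i j =
  trans (cong₂ _+_ (i*i≡∣i∣*∣i∣ i) (i*i≡∣i∣*∣i∣ j)) (sym (pos-+ (∣ i ∣ ℕ.* ∣ i ∣) (∣ j ∣ ℕ.* ∣ j ∣)))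

∣norm∣≡1⇒∣a∣²+∣b∣²≤2 : ∀ c a b → ∣ norm c (a , b) ∣ ≡ 1 →
                       ∣ a ∣ ℕ.* ∣ a ∣ ℕ.+ ∣ b ∣ ℕ.* ∣ b ∣ ℕ.≤ 2
∣norm∣≡1⇒∣a∣²+∣b∣²≤2 gauss-3 a b ∣N∣≡1 =
  ℕ.≤-trans (ℕ.≤-reflexive (trans (cong ∣_∣ (sym (i*i+j*j≡∣i∣²+∣j∣² a b))) ∣N∣≡1)) (ℕ.n≤1+n 1)
∣norm∣≡1⇒∣a∣²+∣b∣²≤2 eis-4ω+1 a b ∣N∣≡1 = begin
  ∣ a ∣ ℕ.* ∣ a ∣ ℕ.+ ∣ b ∣ ℕ.* ∣ b ∣                               ≤⟨ ℕ.m≤m+n _ _ ⟩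
  ∣ a ∣ ℕ.* ∣ a ∣ ℕ.+ ∣ b ∣ ℕ.* ∣ b ∣ ℕ.+ ∣ a - b ∣ ℕ.* ∣ a - b ∣   ≡⟨ cong ∣_∣ sum≡2N ⟩
  ∣ + 2 * (a * a - a * b + b * b) ∣                                 ≡⟨ abs-* (+ 2) (a * a - a * b + b * b) ⟩
  2 ℕ.* ∣ a * a - a * b + b * b ∣                                   ≡⟨ cong (2 ℕ.*_) ∣N∣≡1 ⟩
  2                                                                 ∎
  where
  open ℕ.≤-Reasoning
  twice-norm : ∀ a b → a * a + b * b + (a - b) * (a - b) ≡ + 2 * (a * a - a * b + b * b)
  twice-norm = solve-∀
  sum≡2N : + (∣ a ∣ ℕ.* ∣ a ∣ ℕ.+ ∣ b ∣ ℕ.* ∣ b ∣ ℕ.+ ∣ a - b ∣ ℕ.* ∣ a - b ∣)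
           ≡ + 2 * (a * a - a * b + b * b)
  sum≡2N = trans (pos-+ (∣ a ∣ ℕ.* ∣ a ∣ ℕ.+ ∣ b ∣ ℕ.* ∣ b ∣) (∣ a - b ∣ ℕ.* ∣ a - b ∣))
    (trans (cong₂ _+_ (sym (i*i+j*j≡∣i∣²+∣j∣² a b)) (sym (i*i≡∣i∣*∣i∣ (a - b)))) (twice-norm a b))
∣norm∣≡1⇒∣a∣²+∣b∣²≤2 eis-4ω+3 = ∣norm∣≡1⇒∣a∣²+∣b∣²≤2 eis-4ω+1

m*m≤2⇒m≤1 : ∀ m → m ℕ.* m ℕ.≤ 2 → m ℕ.≤ 1
m*m≤2⇒m≤1 zero          _    = z≤n
m*m≤2⇒m≤1 (suc zero)    _    = ℕ.≤-refl
m*m≤2⇒m≤1 (suc (suc m)) m²≤2 = ⊥-elim (4≰2 (ℕ.≤-trans 4≤m² m²≤2))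
  where
  4≰2 : ¬ 4 ℕ.≤ 2
  4≰2 (s≤s (s≤s ()))
  4≤m² : 4 ℕ.≤ suc (suc m) ℕ.* suc (suc m)
  4≤m² = ℕ.*-mono-≤ {2} {suc (suc m)} {2} {suc (suc m)} (s≤s (s≤s z≤n)) (s≤s (s≤s z≤n))

-1…1 : List ℤ
-1…1 = -[1+ 0 ] ∷ + 0 ∷ + 1 ∷ []

∣i∣≤1⇒i∈-1…1 : ∀ i → ∣ i ∣ ℕ.≤ 1 → i ∈ -1…1
∣i∣≤1⇒i∈-1…1 -[1+ 0 ]        _        = here refl
∣i∣≤1⇒i∈-1…1 (+ 0)           _        = there (here refl)
∣i∣≤1⇒i∈-1…1 (+ 1)           _        = there (there (here refl))
∣i∣≤1⇒i∈-1…1 (+ suc (suc _)) (s≤s ())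
∣i∣≤1⇒i∈-1…1 -[1+ suc _ ]    (s≤s ())

BoundedUnitsListed : Case → Set
BoundedUnitsListed c = All (λ x → ∣ norm c x ∣ ≡ 1 → x ∈ units c) (cartesianProduct -1…1 -1…1)

boundedUnitsListed? : ∀ c → Dec (BoundedUnitsListed c)
boundedUnitsListed? c = Allₗ.all? (λ x → ∣ norm c x ∣ ℕ.≟ 1 →-dec x ∈? units c) _
  where open DecMembership (≡-dec ℤ._≟_ ℤ._≟_) using (_∈?_)

boundedUnitsListed : ∀ c → BoundedUnitsListed c
boundedUnitsListed gauss-3  = from-yes (boundedUnitsListed? gauss-3)
boundedUnitsListed eis-4ω+1 = from-yes (boundedUnitsListed? eis-4ω+1)
boundedUnitsListed eis-4ω+3 = from-yes (boundedUnitsListed? eis-4ω+3)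

units-complete : ∀ c {x} → IsUnitR c x → x ∈ units c
units-complete c {a , b} x-unit =
  Allₗ.lookup (boundedUnitsListed c) (∈-cartesianProduct⁺ (small a ∣a∣²≤2) (small b ∣b∣²≤2)) ∣N∣≡1
  where
  ∣N∣≡1 : ∣ norm c (a , b) ∣ ≡ 1
  ∣N∣≡1 = ∣norm∣≡1 c x-unit
  small : ∀ i → ∣ i ∣ ℕ.* ∣ i ∣ ℕ.≤ 2 → i ∈ -1…1
  small i i²≤2 = ∣i∣≤1⇒i∈-1…1 i (m*m≤2⇒m≤1 ∣ i ∣ i²≤2)
  ∣a∣²≤2 : ∣ a ∣ ℕ.* ∣ a ∣ ℕ.≤ 2
  ∣a∣²≤2 = ℕ.≤-trans (ℕ.m≤m+n _ _) (∣norm∣≡1⇒∣a∣²+∣b∣²≤2 c a b ∣N∣≡1)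
  ∣b∣²≤2 : ∣ b ∣ ℕ.* ∣ b ∣ ℕ.≤ 2
  ∣b∣²≤2 = ℕ.≤-trans (ℕ.m≤n+m _ _) (∣norm∣≡1⇒∣a∣²+∣b∣²≤2 c a b ∣N∣≡1)

lincomb-1-θ : ∀ c a b → (a , b) ≡ lincomb c ((a , Notation.1R c) ∷ (b , θ) ∷ [])
lincomb-1-θ c a b = cong₂ _,_ (first a b) (second a b)
  where
  first : ∀ a b → a ≡ a * + 1 + (b * + 0 + + 0)
  first = solve-∀
  second : ∀ a b → b ≡ a * + 0 + (b * + 1 + + 0)
  second = solve-∀

-- Finite presentations of R/(p)

record Quotient (c : Case) (q : ℕ) : Set where
  open Notation c
  field
    cls     : R → Fin q
    rep     : Fin q → R
    cls-rep : ∀ k → cls (rep k) ≡ k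
    ≈⇔cls≡  : ∀ x y → x ≈ y ⇔ cls x ≡ cls y
    cls-⊕   : ∀ x x' y y' → cls x ≡ cls x' → cls y ≡ cls y' → cls (x ⊕ y) ≡ cls (x' ⊕ y')
    cls-⊗   : ∀ x x' y y' → cls x ≡ cls x' → cls y ≡ cls y' → cls (x ⊗ y) ≡ cls (x' ⊗ y')

module QuotientProperties {c : Case} {q : ℕ} (Q : Quotient c q) where
  open Notation c
  open Quotient Q
  open Equivalence using (to; from)
  open DecMembership (_≟ᶠ_ {q}) using (_∈?_)

  infixl 6 _+𝔽_
  infixl 7 _*𝔽_

  _+𝔽_ _*𝔽_ : Fin q → Fin q → Fin q
  k +𝔽 l = cls (rep k ⊕ rep l)
  k *𝔽 l = cls (rep k ⊗ rep l)

  1𝔽 : Fin q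
  1𝔽 = cls 1R

  cls≡⇒≈ : ∀ x y → cls x ≡ cls y → x ≈ y
  cls≡⇒≈ x y = from (≈⇔cls≡ x y)

  cls-⊕rep≡+𝔽 : ∀ x k → cls (x ⊕ rep k) ≡ cls x +𝔽 k
  cls-⊕rep≡+𝔽 x k = cls-⊕ x (rep (cls x)) (rep k) (rep k) (sym (cls-rep (cls x))) refl

  cls-⊗≡*𝔽 : ∀ x y → cls (x ⊗ y) ≡ cls x *𝔽 cls y
  cls-⊗≡*𝔽 x y = cls-⊗ x (rep (cls x)) y (rep (cls y)) (sym (cls-rep (cls x))) (sym (cls-rep (cls y)))

  InU𝔽 InFx𝔽 InFx∖U𝔽 : Fin q → Set
  InU𝔽 k = k ∈ map cls (units c)
  InFx𝔽 k = ∃ λ l → k *𝔽 l ≡ 1𝔽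
  InFx∖U𝔽 k = InFx𝔽 k × ¬ InU𝔽 k

  InU𝔽? : ∀ k → Dec (InU𝔽 k)
  InU𝔽? k = k ∈? map cls (units c)

  InFx𝔽? : ∀ k → Dec (InFx𝔽 k)
  InFx𝔽? k = any? (λ l → k *𝔽 l ≟ᶠ 1𝔽)

  InFx∖U𝔽? : ∀ k → Dec (InFx∖U𝔽 k)
  InFx∖U𝔽? k = InFx𝔽? k ×-dec ¬? (InU𝔽? k)

  InU⇔InU𝔽 : ∀ x → InU c x ⇔ InU𝔽 (cls x)
  InU⇔InU𝔽 x = mk⇔ to′ from′
    where
    to′ : InU c x → InU𝔽 (cls x)
    to′ (u , u-unit , x≈u) =
      subst (_∈ map cls (units c)) (sym (to (≈⇔cls≡ x u) x≈u)) (∈-map⁺ cls (units-complete c u-unit))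
    from′ : InU𝔽 (cls x) → InU c x
    from′ x∈ with ∈-map⁻ cls x∈
    ... | u , u∈units , x≡u = u , Allₗ.lookup (units-sound c) u∈units , cls≡⇒≈ x u x≡u

  InFx⇔InFx𝔽 : ∀ x → InFx c x ⇔ InFx𝔽 (cls x)
  InFx⇔InFx𝔽 x = mk⇔ to′ from′
    where
    to′ : InFx c x → InFx𝔽 (cls x)
    to′ (y , x⊗y≈1) = cls y , trans (sym (cls-⊗≡*𝔽 x y)) (to (≈⇔cls≡ (x ⊗ y) 1R) x⊗y≈1)
    from′ : InFx𝔽 (cls x) → InFx c x
    from′ (l , x*l≡1) = rep l , cls≡⇒≈ (x ⊗ rep l) 1R
      (trans (cls-⊗≡*𝔽 x (rep l)) (trans (cong (cls x *𝔽_) (cls-rep l)) x*l≡1))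

  InFx∖U⇔InFx∖U𝔽 : ∀ x → InFx∖U c x ⇔ InFx∖U𝔽 (cls x)
  InFx∖U⇔InFx∖U𝔽 x = mk⇔
    (λ (x∈ , x∉) → to (InFx⇔InFx𝔽 x) x∈ , x∉ ∘′ from (InU⇔InU𝔽 x))
    (λ (x∈ , x∉) → from (InFx⇔InFx𝔽 x) x∈ , x∉ ∘′ to (InU⇔InU𝔽 x))

  InU-rep : ∀ {k} → InU𝔽 k → InU c (rep k)
  InU-rep {k} = from (InU⇔InU𝔽 (rep k)) ∘′ subst InU𝔽 (sym (cls-rep k))

  InFx∖U-rep : ∀ {k} → InFx∖U𝔽 k → InFx∖U c (rep k)
  InFx∖U-rep {k} = from (InFx∖U⇔InFx∖U𝔽 (rep k)) ∘′ subst InFx∖U𝔽 (sym (cls-rep k))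

  Part1𝔽 : Set
  Part1𝔽 = ∃ λ g → InFx∖U𝔽 g × InU𝔽 (g *𝔽 g) ×
                   (∀ k → InFx𝔽 k → InU𝔽 k ⊎ ∃ λ j → InU𝔽 j × k ≡ g *𝔽 j)

  part1 : Part1𝔽 → Part1 c
  part1 (g , g∈ , g²∈ , cosets) = rep g , InFx∖U-rep g∈ , from (InU⇔InU𝔽 (rep g ⊗ rep g)) g²∈ , coset
    where
    coset : ∀ y → InFx c y → InU c y ⊎ ∃ λ u → InU c u × y ≈ rep g ⊗ u
    coset y y∈ with cosets (cls y) (to (InFx⇔InFx𝔽 y) y∈)
    ... | inj₁ y∈U            = inj₁ (from (InU⇔InU𝔽 y) y∈U)
    ... | inj₂ (j , j∈U , y≡) = inj₂ (rep j , InU-rep j∈U , cls≡⇒≈ y (rep g ⊗ rep j) y≡)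

  partialSums𝔽 : Fin q → List (Fin q) → List (Fin q)
  partialSums𝔽 k []       = []
  partialSums𝔽 k (j ∷ js) = k +𝔽 j ∷ partialSums𝔽 (k +𝔽 j) js

  Walk𝔽 : Fin q → List (Fin q) → Fin q → Set
  Walk𝔽 k js t = All InU𝔽 js × All InFx∖U𝔽 (partialSums𝔽 k js) × t ≡ foldl _+𝔽_ k js

  Walk𝔽? : ∀ k js t → Dec (Walk𝔽 k js t)
  Walk𝔽? k js t =
    Allₗ.all? InU𝔽? js ×-dec Allₗ.all? InFx∖U𝔽? (partialSums𝔽 k js) ×-dec t ≟ᶠ foldl _+𝔽_ k js

  cls-partialSums : ∀ l js → map cls (partialSums c l (map rep js)) ≡ partialSums𝔽 (cls l) js
  cls-partialSums l []       = refl
  cls-partialSums l (j ∷ js) = cong₂ _∷_ (cls-⊕rep≡+𝔽 l j)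
    (trans (cls-partialSums (l ⊕ rep j) js) (cong (λ k → partialSums𝔽 k js) (cls-⊕rep≡+𝔽 l j)))

  cls-sumFrom : ∀ l js → cls (sumFrom c l (map rep js)) ≡ foldl _+𝔽_ (cls l) js
  cls-sumFrom l []       = refl
  cls-sumFrom l (j ∷ js) =
    trans (cls-sumFrom (l ⊕ rep j) js) (cong (λ k → foldl _+𝔽_ k js) (cls-⊕rep≡+𝔽 l j))

  lift-walk : ∀ l js n → Walk𝔽 (cls l) js (cls n) →
              All (InU c) (map rep js) × All (InFx∖U c) (partialSums c l (map rep js)) × n ≈ sumFrom c l (map rep js)
  lift-walk l js n (js∈U , sums∈ , n≡) =
    map⁺ (Allₗ.map InU-rep js∈U) ,
    Allₗ.map (λ {x} → from (InFx∖U⇔InFx∖U𝔽 x))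
             (map⁻ (subst (All InFx∖U𝔽) (sym (cls-partialSums l js)) sums∈)) ,
    cls≡⇒≈ n (sumFrom c l (map rep js)) (trans n≡ (sym (cls-sumFrom l js)))

  Part2𝔽 : Set
  Part2𝔽 = ∀ k t → InFx∖U𝔽 k → InFx∖U𝔽 t → k ≢ t →
           (∃ λ j → Walk𝔽 k (j ∷ []) t) ⊎ (∃₂ λ j₁ j₂ → Walk𝔽 k (j₁ ∷ j₂ ∷ []) t)

  part2 : Part2𝔽 → Part2 c
  part2 walks l n l∈ n∈ l≉n
    with walks (cls l) (cls n) (to (InFx∖U⇔InFx∖U𝔽 l) l∈) (to (InFx∖U⇔InFx∖U𝔽 n) n∈)
               (l≉n ∘′ cls≡⇒≈ l n)
  ... | inj₁ (j , w)       = rep j ∷ [] , lift-walk l (j ∷ []) n w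
  ... | inj₂ (j₁ , j₂ , w) = rep j₁ ∷ rep j₂ ∷ [] , lift-walk l (j₁ ∷ j₂ ∷ []) n w

  part3 : Part3 c
  part3 (a , b) = (a , 1R) ∷ (b , θ) ∷ [] , unit (here refl) ∷ unit (there (there (here refl))) ∷ [] ,
                  cls≡⇒≈ (a , b) _ (cong cls (lincomb-1-θ c a b))
    where
    open All using ([]; _∷_)
    unit : ∀ {u} → u ∈ units c → InU c u
    unit {u} u∈ = u , Allₗ.lookup (units-sound c) u∈ , cls≡⇒≈ u u refl

  Part4𝔽 : Set
  Part4𝔽 = InFx∖U𝔽 (cls 2R) ⊎
    ∃₂ λ j₁ j₂ → InU𝔽 j₁ × InU𝔽 j₂ × InFx∖U𝔽 (j₁ +𝔽 j₂) ×
                 InFx∖U𝔽 (cls ((+ 2) · rep j₁ ⊕ rep j₂)) × InU𝔽 (cls ((+ 3) · rep j₁ ⊕ rep j₂))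

  part4 : Part4𝔽 → Part4 c
  part4 (inj₁ 2∈) = inj₁ (from (InFx∖U⇔InFx∖U𝔽 2R) 2∈)
  part4 (inj₂ (j₁ , j₂ , j₁∈ , j₂∈ , s₁∈ , s₂∈ , s₃∈)) =
    inj₂ (rep j₁ , rep j₂ , InU-rep j₁∈ , InU-rep j₂∈ ,
          from (InFx∖U⇔InFx∖U𝔽 (rep j₁ ⊕ rep j₂)) s₁∈ ,
          from (InFx∖U⇔InFx∖U𝔽 ((+ 2) · rep j₁ ⊕ rep j₂)) s₂∈ ,
          from (InU⇔InU𝔽 ((+ 3) · rep j₁ ⊕ rep j₂)) s₃∈)

  Part5𝔽 : Set
  Part5𝔽 = ∀ k → InFx∖U𝔽 k → ∃₂ λ j₁ j₂ → InU𝔽 j₁ × InU𝔽 j₂ × k ≡ j₁ +𝔽 j₂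

  part5 : Part5𝔽 → Part5 c
  part5 sums l l∈ with sums (cls l) (to (InFx∖U⇔InFx∖U𝔽 l) l∈)
  ... | j₁ , j₂ , j₁∈ , j₂∈ , l≡ =
    rep j₁ , rep j₂ , InU-rep j₁∈ , InU-rep j₂∈ , cls≡⇒≈ l (rep j₁ ⊕ rep j₂) l≡

  Parts𝔽 : Set
  Parts𝔽 = Part1𝔽 × Part2𝔽 × Part4𝔽 × Part5𝔽

  Parts𝔽? : Dec Parts𝔽
  Parts𝔽? = part1? ×-dec part2? ×-dec part4? ×-dec part5?
    where
    part1? : Dec Part1𝔽
    part1? = any? λ g → InFx∖U𝔽? g ×-dec InU𝔽? (g *𝔽 g) ×-dec
               all? λ k → InFx𝔽? k →-dec (InU𝔽? k ⊎-dec any? λ j → InU𝔽? j ×-dec k ≟ᶠ g *𝔽 j)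
    part2? : Dec Part2𝔽
    part2? = all? λ k → all? λ t → InFx∖U𝔽? k →-dec InFx∖U𝔽? t →-dec ¬? (k ≟ᶠ t) →-dec
               ((any? λ j → Walk𝔽? k (j ∷ []) t) ⊎-dec
                (any? λ j₁ → any? λ j₂ → Walk𝔽? k (j₁ ∷ j₂ ∷ []) t))
    part4? : Dec Part4𝔽
    part4? = InFx∖U𝔽? (cls 2R) ⊎-dec any? λ j₁ → any? λ j₂ →
               InU𝔽? j₁ ×-dec InU𝔽? j₂ ×-dec InFx∖U𝔽? (j₁ +𝔽 j₂) ×-dec
               InFx∖U𝔽? (cls ((+ 2) · rep j₁ ⊕ rep j₂)) ×-dec InU𝔽? (cls ((+ 3) · rep j₁ ⊕ rep j₂))
    part5? : Dec Part5𝔽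
    part5? = all? λ k → InFx∖U𝔽? k →-dec
               any? λ j₁ → any? λ j₂ → InU𝔽? j₁ ×-dec InU𝔽? j₂ ×-dec k ≟ᶠ j₁ +𝔽 j₂

  all-parts : True Parts𝔽? → Part1 c × Part2 c × Part3 c × Part4 c × Part5 c
  all-parts decided with toWitness decided
  ... | p₁ , p₂ , p₄ , p₅ = part1 p₁ , part2 p₂ , part3 , part4 p₄ , part5 p₅

-- ℤ[ι]/(3) as Fin 9 ≅ Fin 3 × Fin 3

module GaussianQuotient where
  open Notation gauss-3
  open Equivalence using (to; from)

  ⊗p≡3* : ∀ s t → (s , t) ⊗ p ≡ (s * + 3 , t * + 3)
  ⊗p≡3* s t = cong₂ _,_ (solve (s ∷ t ∷ [])) (solve (s ∷ t ∷ []))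

  Coordinatewise : R → R → Set
  Coordinatewise x y = proj₁ x ≡ proj₁ y modulo 3 × proj₂ x ≡ proj₂ y modulo 3

  ≈⇔coordinatewise : ∀ x y → x ≈ y ⇔ Coordinatewise x y
  ≈⇔coordinatewise x y = mk⇔ to′ from′
    where
    to′ : x ≈ y → Coordinatewise x y
    to′ ((s , t) , eq) = congruent (divides s (cong proj₁ x⊖y≡)) , congruent (divides t (cong proj₂ x⊖y≡))
      where
      x⊖y≡ : x ⊖ y ≡ (s * + 3 , t * + 3)
      x⊖y≡ = trans (sym eq) (⊗p≡3* s t)
    from′ : Coordinatewise x y → x ≈ y
    from′ (congruent (divides s eq₁) , congruent (divides t eq₂)) =
      (s , t) , trans (⊗p≡3* s t) (sym (cong₂ _,_ eq₁ eq₂))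

  cls : R → Fin 9
  cls (a , b) = combine (a mod 3) (b mod 3)

  rep : Fin 9 → R
  rep k = + toℕ (proj₁ (remQuot {3} 3 k)) , + toℕ (proj₂ (remQuot {3} 3 k))

  cls-rep : ∀ k → cls (rep k) ≡ k
  cls-rep k = trans (cong₂ combine (mod-toℕ {3} (proj₁ (remQuot {3} 3 k))) (mod-toℕ {3} (proj₂ (remQuot {3} 3 k))))
                    (combine-remQuot {3} 3 k)

  cls≡⇔coordinatewise : ∀ x y → cls x ≡ cls y ⇔ Coordinatewise x y
  cls≡⇔coordinatewise (a , b) (a' , b') = mk⇔
    (λ eq → let (a≡ , b≡) = combine-injective _ _ _ _ eq in mod≡⇒≡-mod a a' a≡ , mod≡⇒≡-mod b b' b≡)
    (λ (a≡ , b≡) → cong₂ combine (≡-mod⇒mod≡ a≡) (≡-mod⇒mod≡ b≡))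

  cls-⊕ : ∀ x x' y y' → cls x ≡ cls x' → cls y ≡ cls y' → cls (x ⊕ y) ≡ cls (x' ⊕ y')
  cls-⊕ x x' y y' x≡x' y≡y' with to (cls≡⇔coordinatewise x x') x≡x' | to (cls≡⇔coordinatewise y y') y≡y'
  ... | a≡ , b≡ | a'≡ , b'≡ =
    from (cls≡⇔coordinatewise (x ⊕ y) (x' ⊕ y')) (≡-mod-+ a≡ a'≡ , ≡-mod-+ b≡ b'≡)

  cls-⊗ : ∀ x x' y y' → cls x ≡ cls x' → cls y ≡ cls y' → cls (x ⊗ y) ≡ cls (x' ⊗ y')
  cls-⊗ x x' y y' x≡x' y≡y' with to (cls≡⇔coordinatewise x x') x≡x' | to (cls≡⇔coordinatewise y y') y≡y'
  ... | a≡ , b≡ | a'≡ , b'≡ = from (cls≡⇔coordinatewise (x ⊗ y) (x' ⊗ y'))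
    (≡-mod-+ (≡-mod-* a≡ a'≡) (≡-mod-neg (≡-mod-* b≡ b'≡)) ,
     ≡-mod-+ (≡-mod-* a≡ b'≡) (≡-mod-* b≡ a'≡))

  quotient : Quotient gauss-3 9
  quotient = record
    { cls     = cls
    ; rep     = rep
    ; cls-rep = cls-rep
    ; ≈⇔cls≡  = λ x y → ⇔-trans (≈⇔coordinatewise x y) (⇔-sym (cls≡⇔coordinatewise x y))
    ; cls-⊕   = cls-⊕
    ; cls-⊗   = cls-⊗
    }

-- ℤ[ω]/(p) as Fin 13, through ω ↦ r

evalω : ℤ → R → ℤ
evalω r (a , b) = a + r * b

evalω-⊗-modulo : ∀ r k → r * r + r + + 1 ≡ k * + 13 → ∀ a b a' b' →
                 (a * a' - b * b') + r * (a * b' + b * a' - b * b') ≡ (a + r * b) * (a' + r * b') modulo 13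
evalω-⊗-modulo r k root a b a' b' = congruent (divides (- (b * b') * k) (begin
  (a * a' - b * b') + r * (a * b' + b * a' - b * b') - (a + r * b) * (a' + r * b')
    ≡⟨ solve (r ∷ a ∷ b ∷ a' ∷ b' ∷ []) ⟩
  - (b * b') * (r * r + r + + 1)  ≡⟨ cong (- (b * b') *_) root ⟩
  - (b * b') * (k * + 13)         ≡⟨ *-assoc (- (b * b')) k (+ 13) ⟨
  - (b * b') * k * + 13           ∎))
  where open ≡-Reasoning

module EisensteinQuotient (c : Case) (r : ℤ)
  (evalω-⊗ : ∀ x y → evalω r (mulR c x y) ≡ evalω r x * evalω r y modulo 13)
  (13∣p : + 13 ∣ evalω r (primeOf c))
  (multiples-of-p : ∀ b e → ∃ λ w → mulR c w (primeOf c) ≡ (e * + 13 - r * b , b))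
  where
  open Notation c
  open Equivalence using (to; from)

  evalω-⊕ : ∀ x y → evalω r (x ⊕ y) ≡ evalω r x + evalω r y
  evalω-⊕ (a , b) (a' , b') = linear r a b a' b'
    where
    linear : ∀ r a b a' b' → (a + a') + r * (b + b') ≡ (a + r * b) + (a' + r * b')
    linear = solve-∀

  evalω-⊖ : ∀ x y → evalω r (x ⊖ y) ≡ evalω r x - evalω r y
  evalω-⊖ (a , b) (a' , b') = linear r a b a' b'
    where
    linear : ∀ r a b a' b' → (a - a') + r * (b - b') ≡ (a + r * b) - (a' + r * b')
    linear = solve-∀

  ≈⇔evalω≡ : ∀ x y → x ≈ y ⇔ (evalω r x ≡ evalω r y modulo 13)
  ≈⇔evalω≡ x@(a , b) y@(a' , b') = mk⇔ to′ from′
    where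
    to′ : x ≈ y → evalω r x ≡ evalω r y modulo 13
    to′ (w , w⊗p≡x⊖y) =
      congruent (subst (+ 13 ∣_) (trans (cong (evalω r) w⊗p≡x⊖y) (evalω-⊖ x y)) 13∣w⊗p)
      where
      13∣w⊗p : + 13 ∣ evalω r (w ⊗ p)
      13∣w⊗p = ∣m+n∣n⇒∣m (divides-difference (evalω-⊗ w p)) (∣m⇒∣-m (∣n⇒∣m*n (evalω r w) 13∣p))
    from′ : evalω r x ≡ evalω r y modulo 13 → x ≈ y
    from′ (congruent (divides e eq)) = subst (p ∣R_) (sym (cong₂ _,_ a-a'≡ refl)) (multiples-of-p (b - b') e)
      where
      linear : ∀ r a b a' b' → a - a' ≡ ((a + r * b) - (a' + r * b')) - r * (b - b')
      linear = solve-∀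
      a-a'≡ : a - a' ≡ e * + 13 - r * (b - b')
      a-a'≡ = trans (linear r a b a' b') (cong (_- r * (b - b')) eq)

  cls : R → Fin 13
  cls x = evalω r x mod 13

  rep : Fin 13 → R
  rep k = + toℕ k , + 0

  cls-rep : ∀ k → cls (rep k) ≡ k
  cls-rep k =
    trans (cong (_mod 13) (trans (cong (_+_ (+ toℕ k)) (*-zeroʳ r)) (+-identityʳ (+ toℕ k)))) (mod-toℕ {13} k)

  cls≡⇔evalω≡ : ∀ x y → cls x ≡ cls y ⇔ (evalω r x ≡ evalω r y modulo 13)
  cls≡⇔evalω≡ x y = mk⇔ (mod≡⇒≡-mod (evalω r x) (evalω r y)) ≡-mod⇒mod≡

  cls-⊕ : ∀ x x' y y' → cls x ≡ cls x' → cls y ≡ cls y' → cls (x ⊕ y) ≡ cls (x' ⊕ y')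
  cls-⊕ x x' y y' x≡x' y≡y' = from (cls≡⇔evalω≡ (x ⊕ y) (x' ⊕ y'))
    (subst₂ (_≡_modulo 13) (sym (evalω-⊕ x y)) (sym (evalω-⊕ x' y'))
      (≡-mod-+ (to (cls≡⇔evalω≡ x x') x≡x') (to (cls≡⇔evalω≡ y y') y≡y')))

  cls-⊗ : ∀ x x' y y' → cls x ≡ cls x' → cls y ≡ cls y' → cls (x ⊗ y) ≡ cls (x' ⊗ y')
  cls-⊗ x x' y y' x≡x' y≡y' = from (cls≡⇔evalω≡ (x ⊗ y) (x' ⊗ y'))
    (≡-mod-trans (evalω-⊗ x y)
      (≡-mod-trans (≡-mod-* (to (cls≡⇔evalω≡ x x') x≡x') (to (cls≡⇔evalω≡ y y') y≡y'))
        (≡-mod-sym (evalω-⊗ x' y'))))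

  quotient : Quotient c 13
  quotient = record
    { cls     = cls
    ; rep     = rep
    ; cls-rep = cls-rep
    ; ≈⇔cls≡  = λ x y → ⇔-trans (≈⇔evalω≡ x y) (⇔-sym (cls≡⇔evalω≡ x y))
    ; cls-⊕   = cls-⊕
    ; cls-⊗   = cls-⊗
    }

evalω3-⊗ : ∀ x y → evalω (+ 3) (mulR eis-4ω+1 x y) ≡ evalω (+ 3) x * evalω (+ 3) y modulo 13
evalω3-⊗ (a , b) (a' , b') = evalω-⊗-modulo (+ 3) (+ 1) refl a b a' b'

-- 13 = (−3 − 4ω)(1 + 4ω) and ω − 3 = (1 + ω)(1 + 4ω)
multiples-of-4ω+1 : ∀ b e → ∃ λ w → mulR eis-4ω+1 w (primeOf eis-4ω+1) ≡ (e * + 13 - + 3 * b , b)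
multiples-of-4ω+1 b e = (b - + 3 * e , b - + 4 * e) , cong₂ _,_ (solve (b ∷ e ∷ [])) (solve (b ∷ e ∷ []))

evalω9-⊗ : ∀ x y → evalω (+ 9) (mulR eis-4ω+3 x y) ≡ evalω (+ 9) x * evalω (+ 9) y modulo 13
evalω9-⊗ (a , b) (a' , b') = evalω-⊗-modulo (+ 9) (+ 7) refl a b a' b'

-- 13 = (−1 − 4ω)(3 + 4ω) and ω − 9 = (1 + 3ω)(3 + 4ω)
multiples-of-4ω+3 : ∀ b e → ∃ λ w → mulR eis-4ω+3 w (primeOf eis-4ω+3) ≡ (e * + 13 - + 9 * b , b)
multiples-of-4ω+3 b e = (b - e , + 3 * b - + 4 * e) , cong₂ _,_ (solve (b ∷ e ∷ [])) (solve (b ∷ e ∷ []))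

ℤ[ι]/3 : Quotient gauss-3 9
ℤ[ι]/3 = GaussianQuotient.quotient

ℤ[ω]/4ω+1 : Quotient eis-4ω+1 13
ℤ[ω]/4ω+1 = EisensteinQuotient.quotient eis-4ω+1 (+ 3) evalω3-⊗ (divides (+ 1) refl) multiples-of-4ω+1

ℤ[ω]/4ω+3 : Quotient eis-4ω+3 13
ℤ[ω]/4ω+3 = EisensteinQuotient.quotient eis-4ω+3 (+ 9) evalω9-⊗ (divides (+ 3) refl) multiples-of-4ω+3

-- The argument _ : True Parts𝔽? is found by running the decision procedure Parts𝔽?.
lemma2p42 : (c : Case) → Part1 c × Part2 c × Part3 c × Part4 c × Part5 c
lemma2p42 gauss-3  = QuotientProperties.all-parts ℤ[ι]/3 _
lemma2p42 eis-4ω+1 = QuotientProperties.all-parts ℤ[ω]/4ω+1 _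
lemma2p42 eis-4ω+3 = QuotientProperties.all-parts ℤ[ω]/4ω+3 _
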